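{- Let $G$ be a finite simple claw-free graph with maximal degree $d$, let $u\in V(G)$, and let $v_1,v_2\in N(u)$ be two distinct vertices with $\{v_1,v_2\}\notin E(G)$. Then \[\#\big(\dot{N}(u)\cup(N(v_1)\cap N(v_2))\big)\le \left\lfloor \frac{3d+2}{2}\right\rfloor.\]
   Context: For a vertex $x$ of $G$, $N(x)$ is the set of neighbours of $x$ and $\dot{N}(x)=N(x)\cup\{x\}$; $\#$ denotes cardinality. A graph is claw-free if it has no induced subgraph consisting of a vertex adjacent to three pairwise non-adjacent vertices. -}

module Defs where

open import Data.Nat using (ℕ; _≤_; _/_)
open import Data.Bool using (Bool; true; false)
open import Data.Fin using (Fin)
open import Data.Fin.Subset using (Subset; ∣_∣; _∪_; _∩_; ⁅_⁆)
open import Data.Vec using (tabulate)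
open import Data.Product using (Σ; ∃; _×_)
open import Relation.Binary.PropositionalEquality using (_≡_; _≢_)
open import Relation.Nullary using (¬_)
open import Data.Empty using (⊥)

record Graph (n : ℕ) : Set where
  field
    adj     : Fin n → Fin n → Bool
    sym     : ∀ x y → adj x y ≡ adj y x
    irrefl  : ∀ x → adj x x ≡ false

open Graph public

Adj : ∀ {n} → Graph n → Fin n → Fin n → Set
Adj G x y = adj G x y ≡ true

N : ∀ {n} → Graph n → Fin n → Subset n
N G x = tabulate (adj G x)

Ṅ : ∀ {n} → Graph n → Fin n → Subset n
Ṅ G x = N G x ∪ ⁅ x ⁆

degree : ∀ {n} → Graph n → Fin n → ℕ
degree G x = ∣ N G x ∣

MaxDegree : ∀ {n} → Graph n → ℕ → Set
MaxDegree G d = (∀ x → degree G x ≤ d) × ∃ λ x → degree G x ≡ d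

ClawFree : ∀ {n} → Graph n → Set
ClawFree G = ∀ c a b e → Adj G c a → Adj G c b → Adj G c e →
  a ≢ b → a ≢ e → b ≢ e →
  ¬ Adj G a b → ¬ Adj G a e → ¬ Adj G b e → ⊥

-- Write S = Ṅ(u) ∪ (N(v₁) ∩ N(v₂)). Since u ∈ N(v₁) ∩ N(v₂), S = N(u) ∪ (N(v₁) ∩ N(v₂)),
-- so #S ≤ #N(u) + #(N(v₁) ∩ N(v₂)). Claw-freeness at u forces every neighbour of u
-- other than v₁, v₂ to be adjacent to v₁ or v₂, so S ⊆ N(v₁) ∪ N(v₂) ∪ {v₁, v₂} and
-- #S ≤ #(N(v₁) ∪ N(v₂)) + 2. Adding the two bounds and applying inclusion–exclusion
-- gives 2·#S ≤ #N(u) + #N(v₁) + #N(v₂) + 2 ≤ 3d + 2.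
module Submission where

open import Defs hiding (sym)
open import Data.Nat using (ℕ; _≤_; _+_; _*_; _/_; suc)
open import Data.Nat.Properties using (m≤m+n; +-suc; +-identityʳ; *-comm; +-mono-≤; +-monoʳ-≤; ≤-refl; module ≤-Reasoning)
open import Data.Nat.Tactic.RingSolver using (solve-∀)
open import Data.Nat.DivMod using (m*n/n≡m; /-monoˡ-≤)
open import Data.Bool using (true) renaming (_≟_ to _≟ᵇ_)
open import Data.Fin using (Fin; _≟_)
open import Data.Fin.Subset using (Subset; inside; outside; _∈_; _⊆_; ∣_∣; _∪_; _∩_; ⁅_⁆)
open import Data.Fin.Subset.Properties
  using (x∈p∪q⁺; x∈p∪q⁻; p⊆p∪q; q⊆p∪q; p∩q⊆p; x∈p∩q⁺; x∈⁅x⁆; x∈⁅y⁆⇒x≡y; ∣⁅x⁆∣≡1; p⊆q⇒∣p∣≤∣q∣)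
open import Data.Vec using ([]; _∷_)
open import Data.Vec.Properties using (lookup∘tabulate; []=⇒lookup; lookup⇒[]=)
open import Data.Product using (_,_)
open import Data.Sum using (inj₁; inj₂)
open import Data.Empty using (⊥-elim)
open import Function using (_∘_)
open import Relation.Binary.PropositionalEquality using (_≡_; _≢_; refl; sym; trans; cong; cong₂; subst)
open import Relation.Nullary using (¬_; yes; no)

∣p∪q∣+∣p∩q∣≡∣p∣+∣q∣ : ∀ {n} (p q : Subset n) → ∣ p ∪ q ∣ + ∣ p ∩ q ∣ ≡ ∣ p ∣ + ∣ q ∣
∣p∪q∣+∣p∩q∣≡∣p∣+∣q∣ []            []            = refl
∣p∪q∣+∣p∩q∣≡∣p∣+∣q∣ (inside  ∷ p) (inside  ∷ q) =
  cong suc (trans (+-suc ∣ p ∪ q ∣ ∣ p ∩ q ∣)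
                  (trans (cong suc (∣p∪q∣+∣p∩q∣≡∣p∣+∣q∣ p q)) (sym (+-suc ∣ p ∣ ∣ q ∣))))
∣p∪q∣+∣p∩q∣≡∣p∣+∣q∣ (inside  ∷ p) (outside ∷ q) = cong suc (∣p∪q∣+∣p∩q∣≡∣p∣+∣q∣ p q)
∣p∪q∣+∣p∩q∣≡∣p∣+∣q∣ (outside ∷ p) (inside  ∷ q) =
  trans (cong suc (∣p∪q∣+∣p∩q∣≡∣p∣+∣q∣ p q)) (sym (+-suc ∣ p ∣ ∣ q ∣))
∣p∪q∣+∣p∩q∣≡∣p∣+∣q∣ (outside ∷ p) (outside ∷ q) = ∣p∪q∣+∣p∩q∣≡∣p∣+∣q∣ p q

∣p∪q∣≤∣p∣+∣q∣ : ∀ {n} (p q : Subset n) → ∣ p ∪ q ∣ ≤ ∣ p ∣ + ∣ q ∣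
∣p∪q∣≤∣p∣+∣q∣ p q = begin
  ∣ p ∪ q ∣               ≤⟨ m≤m+n ∣ p ∪ q ∣ ∣ p ∩ q ∣ ⟩
  ∣ p ∪ q ∣ + ∣ p ∩ q ∣   ≡⟨ ∣p∪q∣+∣p∩q∣≡∣p∣+∣q∣ p q ⟩
  ∣ p ∣ + ∣ q ∣           ∎
  where open ≤-Reasoning

∪-lub : ∀ {n} {p q r : Subset n} → p ⊆ r → q ⊆ r → p ∪ q ⊆ r
∪-lub {p = p} {q} p⊆r q⊆r x∈p∪q with x∈p∪q⁻ p q x∈p∪q
... | inj₁ x∈p = p⊆r x∈p
... | inj₂ x∈q = q⊆r x∈q

x∈p⇒⁅x⁆⊆p : ∀ {n} {x : Fin n} {p : Subset n} → x ∈ p → ⁅ x ⁆ ⊆ p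
x∈p⇒⁅x⁆⊆p {x = x} {p} x∈p y∈⁅x⁆ = subst (_∈ p) (sym (x∈⁅y⁆⇒x≡y x y∈⁅x⁆)) x∈p

x∈r⇒[p∪⁅x⁆]∪r⊆p∪r : ∀ {n} {x : Fin n} (p r : Subset n) → x ∈ r → (p ∪ ⁅ x ⁆) ∪ r ⊆ p ∪ r
x∈r⇒[p∪⁅x⁆]∪r⊆p∪r p r x∈r = ∪-lub (∪-lub (p⊆p∪q r) (q⊆p∪q p r ∘ x∈p⇒⁅x⁆⊆p x∈r)) (q⊆p∪q p r)

module _ {n : ℕ} (G : Graph n) where

  Adj-sym : ∀ {x y} → Adj G x y → Adj G y x
  Adj-sym {x} {y} = trans (Graph.sym G y x)

  ∈N⇒Adj : ∀ {x y} → y ∈ N G x → Adj G x y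
  ∈N⇒Adj {x} {y} y∈Nx = trans (sym (lookup∘tabulate (adj G x) y)) ([]=⇒lookup y∈Nx)

  Adj⇒∈N : ∀ {x y} → Adj G x y → y ∈ N G x
  Adj⇒∈N {x} {y} xy = lookup⇒[]= y (N G x) (trans (lookup∘tabulate (adj G x) y) xy)

  clawFree⇒N⊆N∪N∪⁅⁆∪⁅⁆ : ClawFree G → ∀ {c a b} → Adj G c a → Adj G c b → a ≢ b → ¬ Adj G a b →
    N G c ⊆ (N G a ∪ N G b) ∪ (⁅ a ⁆ ∪ ⁅ b ⁆)
  clawFree⇒N⊆N∪N∪⁅⁆∪⁅⁆ cf {c} {a} {b} ca cb a≢b ¬ab {x} x∈Nc
    with x ≟ a | x ≟ b | adj G a x ≟ᵇ true | adj G b x ≟ᵇ true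
  ... | yes refl | _        | _      | _      = x∈p∪q⁺ (inj₂ (x∈p∪q⁺ (inj₁ (x∈⁅x⁆ x))))
  ... | _        | yes refl | _      | _      = x∈p∪q⁺ (inj₂ (x∈p∪q⁺ (inj₂ (x∈⁅x⁆ x))))
  ... | _        | _        | yes ax | _      = x∈p∪q⁺ (inj₁ (x∈p∪q⁺ (inj₁ (Adj⇒∈N ax))))
  ... | _        | _        | _      | yes bx = x∈p∪q⁺ (inj₁ (x∈p∪q⁺ (inj₂ (Adj⇒∈N bx))))
  ... | no x≢a   | no x≢b   | no ¬ax | no ¬bx =
    ⊥-elim (cf c a b x ca cb (∈N⇒Adj x∈Nc) a≢b (x≢a ∘ sym) (x≢b ∘ sym) ¬ab ¬ax ¬bx)

  ∣Ṅ∪N∩N∣≤∣N∣+∣N∩N∣ : ∀ {u v₁ v₂} → Adj G u v₁ → Adj G u v₂ →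
    ∣ Ṅ G u ∪ (N G v₁ ∩ N G v₂) ∣ ≤ ∣ N G u ∣ + ∣ N G v₁ ∩ N G v₂ ∣
  ∣Ṅ∪N∩N∣≤∣N∣+∣N∩N∣ {u} {v₁} {v₂} uv₁ uv₂ = begin
    ∣ Ṅ G u ∪ (N G v₁ ∩ N G v₂) ∣  ≤⟨ p⊆q⇒∣p∣≤∣q∣ (x∈r⇒[p∪⁅x⁆]∪r⊆p∪r (N G u) _ u∈N∩N) ⟩
    ∣ N G u ∪ (N G v₁ ∩ N G v₂) ∣  ≤⟨ ∣p∪q∣≤∣p∣+∣q∣ (N G u) _ ⟩
    ∣ N G u ∣ + ∣ N G v₁ ∩ N G v₂ ∣ ∎
    where
    open ≤-Reasoning
    u∈N∩N : u ∈ N G v₁ ∩ N G v₂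
    u∈N∩N = x∈p∩q⁺ (Adj⇒∈N (Adj-sym uv₁) , Adj⇒∈N (Adj-sym uv₂))

  ∣Ṅ∪N∩N∣≤∣N∪N∣+2 : ClawFree G → ∀ {u v₁ v₂} → Adj G u v₁ → Adj G u v₂ → v₁ ≢ v₂ → ¬ Adj G v₁ v₂ →
    ∣ Ṅ G u ∪ (N G v₁ ∩ N G v₂) ∣ ≤ ∣ N G v₁ ∪ N G v₂ ∣ + 2
  ∣Ṅ∪N∩N∣≤∣N∪N∣+2 cf {u} {v₁} {v₂} uv₁ uv₂ v₁≢v₂ ¬v₁v₂ = begin
    ∣ Ṅ G u ∪ (N G v₁ ∩ N G v₂) ∣                 ≤⟨ p⊆q⇒∣p∣≤∣q∣ S⊆ ⟩
    ∣ (N G v₁ ∪ N G v₂) ∪ (⁅ v₁ ⁆ ∪ ⁅ v₂ ⁆) ∣    ≤⟨ ∣p∪q∣≤∣p∣+∣q∣ (N G v₁ ∪ N G v₂) _ ⟩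
    ∣ N G v₁ ∪ N G v₂ ∣ + ∣ ⁅ v₁ ⁆ ∪ ⁅ v₂ ⁆ ∣    ≤⟨ +-monoʳ-≤ ∣ N G v₁ ∪ N G v₂ ∣ ∣⁅v₁⁆∪⁅v₂⁆∣≤2 ⟩
    ∣ N G v₁ ∪ N G v₂ ∣ + 2                       ∎
    where
    open ≤-Reasoning
    N∪N : Subset n
    N∪N = N G v₁ ∪ N G v₂
    ⊆N∪N : ∀ {p} → p ⊆ N∪N → p ⊆ N∪N ∪ (⁅ v₁ ⁆ ∪ ⁅ v₂ ⁆)
    ⊆N∪N p⊆ = p⊆p∪q _ ∘ p⊆
    ⁅u⁆⊆N∪N : ⁅ u ⁆ ⊆ N∪N
    ⁅u⁆⊆N∪N = p⊆p∪q _ ∘ x∈p⇒⁅x⁆⊆p (Adj⇒∈N (Adj-sym uv₁))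
    S⊆ : Ṅ G u ∪ (N G v₁ ∩ N G v₂) ⊆ N∪N ∪ (⁅ v₁ ⁆ ∪ ⁅ v₂ ⁆)
    S⊆ = ∪-lub (∪-lub (clawFree⇒N⊆N∪N∪⁅⁆∪⁅⁆ cf uv₁ uv₂ v₁≢v₂ ¬v₁v₂) (⊆N∪N ⁅u⁆⊆N∪N))
               (⊆N∪N (p⊆p∪q _ ∘ p∩q⊆p (N G v₁) (N G v₂)))
    ∣⁅v₁⁆∪⁅v₂⁆∣≤2 : ∣ ⁅ v₁ ⁆ ∪ ⁅ v₂ ⁆ ∣ ≤ 2
    ∣⁅v₁⁆∪⁅v₂⁆∣≤2 = subst (∣ ⁅ v₁ ⁆ ∪ ⁅ v₂ ⁆ ∣ ≤_) (cong₂ _+_ (∣⁅x⁆∣≡1 v₁) (∣⁅x⁆∣≡1 v₂))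
                     (∣p∪q∣≤∣p∣+∣q∣ ⁅ v₁ ⁆ ⁅ v₂ ⁆)

m+m≤n⇒m≤n/2 : ∀ {m n} → m + m ≤ n → m ≤ n / 2
m+m≤n⇒m≤n/2 {m} {n} m+m≤n = subst (_≤ n / 2) (m*n/n≡m m 2) (/-monoˡ-≤ 2 (subst (_≤ n) m+m≡m*2 m+m≤n))
  where
  m+m≡m*2 : m + m ≡ m * 2
  m+m≡m*2 = trans (cong (m +_) (sym (+-identityʳ m))) (*-comm 2 m)

mainTheorem5 : ∀ {n : ℕ} (G : Graph n) (d : ℕ) → ClawFree G → MaxDegree G d →
    (u v₁ v₂ : Fin n) → Adj G u v₁ → Adj G u v₂ → v₁ ≢ v₂ → ¬ Adj G v₁ v₂ →
    ∣ Ṅ G u ∪ (N G v₁ ∩ N G v₂) ∣ ≤ (3 * d + 2) / 2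
mainTheorem5 G d cf (deg≤d , _) u v₁ v₂ uv₁ uv₂ v₁≢v₂ ¬v₁v₂ = m+m≤n⇒m≤n/2 (begin
  ∣ S ∣ + ∣ S ∣
    ≤⟨ +-mono-≤ (∣Ṅ∪N∩N∣≤∣N∣+∣N∩N∣ G uv₁ uv₂) (∣Ṅ∪N∩N∣≤∣N∪N∣+2 G cf uv₁ uv₂ v₁≢v₂ ¬v₁v₂) ⟩
  ∣ N G u ∣ + ∣ N G v₁ ∩ N G v₂ ∣ + (∣ N G v₁ ∪ N G v₂ ∣ + 2)
    ≡⟨ regroup (∣ N G u ∣) (∣ N G v₁ ∩ N G v₂ ∣) (∣ N G v₁ ∪ N G v₂ ∣) ⟩
  ∣ N G u ∣ + (∣ N G v₁ ∪ N G v₂ ∣ + ∣ N G v₁ ∩ N G v₂ ∣) + 2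
    ≡⟨ cong (λ k → ∣ N G u ∣ + k + 2) (∣p∪q∣+∣p∩q∣≡∣p∣+∣q∣ (N G v₁) (N G v₂)) ⟩
  ∣ N G u ∣ + (∣ N G v₁ ∣ + ∣ N G v₂ ∣) + 2
    ≤⟨ +-mono-≤ (+-mono-≤ (deg≤d u) (+-mono-≤ (deg≤d v₁) (deg≤d v₂))) ≤-refl ⟩
  d + (d + d) + 2
    ≡⟨ cong (λ k → d + (d + k) + 2) (sym (+-identityʳ d)) ⟩
  3 * d + 2 ∎)
  where
  open ≤-Reasoning
  S = Ṅ G u ∪ (N G v₁ ∩ N G v₂)
  regroup : ∀ a b c → a + b + (c + 2) ≡ a + (c + b) + 2
  regroup = solve-∀
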